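{- Let $M$ be a loopless rank-$4$ matroid that is hypermodular but not modular. Then $M$ is inseparable. Moreover, let $F$ and $L$ be disjoint flats of $M$ of rank $3$ and $2$ respectively, and let $A_1,\dots,A_n$ be all the rank-$3$ flats of $M$ containing $L$. Then $E(M)=A_1\cup\cdots\cup A_n$ with $n\ge3$, the sets $A_i-L$ ($i\in[n]$) are pairwise disjoint, and every set $A_i-(F\sqcup L)$ is nonempty. Moreover, all of $A_1,\dots,A_n$ and $F$ are inseparable.
   Context: A matroid is inseparable (connected) if it has no nontrivial separator; a subset $A\subseteq E(M)$ is inseparable if the restriction $M|_A$ is. A pair of flats $\{A,B\}$ is modular if $r(A\cup B)+r(A\cap B)=r(A)+r(B)$; a matroid is modular if every pair of flats is modular. A rank-$4$ matroid is hypermodular if every pair of two rank-$3$ flats is a modular pair. -}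

module Defs where

open import Data.Nat using (ℕ; _+_; _≤_; _<_)
open import Data.Fin using (Fin)
open import Data.Fin.Subset
  using (Subset; _∈_; _∉_; _⊆_; _∪_; _∩_; _─_; ⁅_⁆; ⊤; ∣_∣; Nonempty; Empty)
open import Data.Product using (_×_)
open import Data.Empty using (⊥)
open import Relation.Binary.PropositionalEquality using (_≡_; _≢_)

record Matroid (m : ℕ) : Set where
  field
    r          : Subset m → ℕ
    r-bounded  : ∀ X → r X ≤ ∣ X ∣
    r-mono     : ∀ {X Y} → X ⊆ Y → r X ≤ r Y
    r-submod   : ∀ X Y → r (X ∪ Y) + r (X ∩ Y) ≤ r X + r Y
open Matroid public

module _ {m : ℕ} (M : Matroid m) where

  IsFlat : Subset m → Set
  IsFlat X = ∀ e → e ∉ X → r M X < r M (X ∪ ⁅ e ⁆)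

  Loopless : Set
  Loopless = ∀ e → r M ⁅ e ⁆ ≡ 1

  HasRank : ℕ → Set
  HasRank k = r M ⊤ ≡ k

  ModularPair : Subset m → Subset m → Set
  ModularPair A B = r M (A ∪ B) + r M (A ∩ B) ≡ r M A + r M B

  IsModular : Set
  IsModular = ∀ A B → IsFlat A → IsFlat B → ModularPair A B

  Hypermodular : Set
  Hypermodular = HasRank 4 ×
    (∀ A B → IsFlat A → IsFlat B → r M A ≡ 3 → r M B ≡ 3 → ModularPair A B)

  IsSeparatorOf : Subset m → Subset m → Set
  IsSeparatorOf A S = S ⊆ A × (r M S + r M (A ─ S) ≡ r M A)

  InseparableSet : Subset m → Set
  InseparableSet A = ∀ S → IsSeparatorOf A S → Nonempty S → S ≢ A → ⊥

  Inseparable : Set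
  Inseparable = InseparableSet ⊤

{-# OPTIONS --safe #-}
-- Call rank-3 flats planes and rank-2 flats lines. In a loopless rank-4 hypermodular
-- matroid two distinct planes meet in a line, and two flats with a common point always
-- form a modular pair (a non-modular one would consist of two planes). If E = S ⊔ T
-- were a separation, a non-modular pair of flats X, Y would stay non-modular on one
-- side, say on S; then (X ∩ S) ∪ T and (Y ∩ S) ∪ T are flats meeting in T that form a
-- non-modular pair, which is impossible.
--
-- In the configuration, the planes A i through L meet pairwise exactly in L, and each
-- meets F in a line K i disjoint from L. A plane containing two disjoint lines is
-- inseparable; this gives A i (lines L, K i) and F (lines K i, K j). The key fact is that
-- two planes X, Y through a point x, each containing a line missing the other plane, do
-- not cover E: choosing a, a′ spanning X with x and b, b′ spanning Y with x, the planes
-- cl {a, x, b′} and cl {b, x, a′} meet in a line whose traces on X and on Y are of rank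
-- at most 1 and share x, so the line leaves X ∪ Y. For A i, A j this yields a third
-- plane A k, hence n ≥ 3. For F, A j it yields c ∉ F ∪ A j; the plane cl (K j ∪ {c})
-- meets F and A j only in K j, so its line of intersection with A i avoids F ∪ L.

module Submission where

open import Defs
open import Data.Nat using (ℕ; zero; suc; _+_; _≤_; _<_; _≤?_; _<?_; z≤n; s≤s)
open import Data.Nat.Properties
open import Data.Fin using (Fin; zero; suc)
open import Data.Fin.Properties using (any?; all?; injective⇒≤)
open import Data.Fin.Subset hiding (⊥)
open import Data.Fin.Subset.Properties
open import Data.Product using (_×_; _,_; ∃; proj₁; proj₂; map₂)
open import Data.Sum using (_⊎_; inj₁; inj₂; [_,_]; [_,_]′; swap)
open import Data.Empty using (⊥; ⊥-elim)
open import Data.Vec using (_∷_; here; there; tabulate)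
open import Data.Vec.Properties using (lookup∘tabulate; lookup⇒[]=; []=⇒lookup)
open import Algebra.Properties.CommutativeSemigroup +-commutativeSemigroup
  using (interchange; xy∙z≈xz∙y; xy∙z≈x∙zy)
open import Function.Base using (_∘_)
open import Function.Definitions using (Injective)
open import Function.Bundles using (_⇔_; Equivalence)
open import Relation.Nullary using (¬_; Dec; yes; no; does; ¬?; _×-dec_; _→-dec_)
open import Relation.Binary.PropositionalEquality
  using (_≡_; _≢_; refl; sym; trans; cong; cong₂; subst; module ≡-Reasoning)

x∈p─q⇒x∉q : ∀ {n} {p q : Subset n} {x} → x ∈ p ─ q → x ∉ q
x∈p─q⇒x∉q {p = _ ∷ _} {q = inside ∷ _} () here
x∈p─q⇒x∉q {p = _ ∷ _} {q = _ ∷ _} (there x∈) (there x∈q) = x∈p─q⇒x∉q x∈ x∈q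

module _ {n : ℕ} {p q r : Subset n} where

  ∪-lub : p ⊆ r → q ⊆ r → p ∪ q ⊆ r
  ∪-lub p⊆r q⊆r x∈ = [ p⊆r , q⊆r ] (x∈p∪q⁻ p q x∈)

  ⊆-∩ : r ⊆ p → r ⊆ q → r ⊆ p ∩ q
  ⊆-∩ r⊆p r⊆q x∈ = x∈p∩q⁺ (r⊆p x∈ , r⊆q x∈)

x∈p⇒⁅x⁆⊆p : ∀ {n} {p : Subset n} {x} → x ∈ p → ⁅ x ⁆ ⊆ p
x∈p⇒⁅x⁆⊆p {p = p} {x} x∈p y∈ = subst (_∈ p) (sym (x∈⁅y⁆⇒x≡y x y∈)) x∈p

module _ {n : ℕ} {p q : Subset n} where

  x∈q⊎x∈p─q : ∀ {x} → x ∈ p → x ∈ q ⊎ x ∈ p ─ q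
  x∈q⊎x∈p─q {x} x∈p with x ∈? q
  ... | yes x∈q = inj₁ x∈q
  ... | no x∉q = inj₂ (x∈p∧x∉q⇒x∈p─q x∈p x∉q)

  p⊆q∪r⇒p⊆p∩q∪p∩r : ∀ {r} → p ⊆ q ∪ r → p ⊆ (p ∩ q) ∪ (p ∩ r)
  p⊆q∪r⇒p⊆p∩q∪p∩r {r} p⊆q∪r {x} x∈p = [ (λ x∈q → p⊆p∪q _ (x∈p∩q⁺ (x∈p , x∈q)))
                                       , (λ x∈r → q⊆p∪q _ _ (x∈p∩q⁺ (x∈p , x∈r))) ] (x∈p∪q⁻ q r (p⊆q∪r x∈p))

  p⊆q∪r⇒p⊆q : ∀ {r} → p ⊆ q ∪ r → (∀ {x} → x ∈ p → x ∉ r) → p ⊆ q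
  p⊆q∪r⇒p⊆q {r} p⊆q∪r p∩r≡∅ {x} x∈p = [ (λ x∈q → x∈q) , (λ x∈r → ⊥-elim (p∩r≡∅ x∈p x∈r)) ]
                                        (x∈p∪q⁻ q r (p⊆q∪r x∈p))

  Empty[p∩q]⇒x∉q : ∀ {x} → Empty (p ∩ q) → x ∈ p → x ∉ q
  Empty[p∩q]⇒x∉q p∩q≡∅ x∈p x∈q = p∩q≡∅ (_ , x∈p∩q⁺ (x∈p , x∈q))

  p⊈q⇒∃ : ¬ (p ⊆ q) → ∃ λ x → x ∈ p × x ∉ q
  p⊈q⇒∃ p⊈q with nonempty? (p ─ q)
  ... | yes (x , x∈) = x , p─q⊆p p q x∈ , x∈p─q⇒x∉q x∈
  ... | no empty = ⊥-elim (p⊈q λ x∈p →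
          [ (λ x∈q → x∈q) , (λ x∈ → ⊥-elim (empty (_ , x∈))) ] (x∈q⊎x∈p─q x∈p))

three-distinct⇒3≤n : ∀ {n} {i j k : Fin n} → i ≢ j → i ≢ k → j ≢ k → 3 ≤ n
three-distinct⇒3≤n {i = i} {j} {k} i≢j i≢k j≢k = injective⇒≤ {f = ijk} ijk-injective
  where
  ijk : Fin 3 → Fin _
  ijk zero = i
  ijk (suc zero) = j
  ijk (suc (suc zero)) = k
  ijk-injective : Injective _≡_ _≡_ ijk
  ijk-injective {zero} {zero} _ = refl
  ijk-injective {zero} {suc zero} i≡j = ⊥-elim (i≢j i≡j)
  ijk-injective {zero} {suc (suc zero)} i≡k = ⊥-elim (i≢k i≡k)
  ijk-injective {suc zero} {zero} j≡i = ⊥-elim (i≢j (sym j≡i))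
  ijk-injective {suc zero} {suc zero} _ = refl
  ijk-injective {suc zero} {suc (suc zero)} j≡k = ⊥-elim (j≢k j≡k)
  ijk-injective {suc (suc zero)} {zero} k≡i = ⊥-elim (i≢k (sym k≡i))
  ijk-injective {suc (suc zero)} {suc zero} k≡j = ⊥-elim (j≢k (sym k≡j))
  ijk-injective {suc (suc zero)} {suc (suc zero)} _ = refl

module MatroidProperties {m : ℕ} (M : Matroid m) where

  ρ : Subset m → ℕ
  ρ = r M

  Line Plane : Subset m → Set
  Line X = IsFlat M X × ρ X ≡ 2
  Plane X = IsFlat M X × ρ X ≡ 3

  NonModularPair : Subset m → Subset m → Set
  NonModularPair X Y = ρ (X ∪ Y) + ρ (X ∩ Y) < ρ X + ρ Y

  ρ-∪ : ∀ X Y → ρ (X ∪ Y) ≤ ρ X + ρ Y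
  ρ-∪ X Y = ≤-trans (m≤m+n _ _) (r-submod M X Y)

  ρ-empty : ∀ {X} → Empty X → ρ X ≡ 0
  ρ-empty {X} empty = n≤0⇒n≡0 (≤-trans (r-bounded M X)
    (≤-reflexive (trans (cong ∣_∣ (Empty-unique empty)) (∣⊥∣≡0 m))))

  ρ>0⇒nonempty : ∀ {X} → 0 < ρ X → Nonempty X
  ρ>0⇒nonempty {X} 0<ρX with nonempty? X
  ... | yes nonempty = nonempty
  ... | no empty = ⊥-elim (<⇒≢ 0<ρX (sym (ρ-empty empty)))

  line-nonempty : ∀ {K} → ρ K ≡ 2 → Nonempty K
  line-nonempty ρK≡2 = ρ>0⇒nonempty (subst (0 <_) (sym ρK≡2) (s≤s z≤n))

  ρ-absorb : ∀ {X Y Z} → Z ⊆ X → Z ⊆ Y → ρ Y ≤ ρ Z → ρ (X ∪ Y) ≤ ρ X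
  ρ-absorb {X} {Y} {Z} Z⊆X Z⊆Y ρY≤ρZ = +-cancelʳ-≤ (ρ Z) _ _ (begin
    ρ (X ∪ Y) + ρ Z        ≤⟨ +-monoʳ-≤ (ρ (X ∪ Y)) (r-mono M (⊆-∩ Z⊆X Z⊆Y)) ⟩
    ρ (X ∪ Y) + ρ (X ∩ Y)  ≤⟨ r-submod M X Y ⟩
    ρ X + ρ Y              ≤⟨ +-monoʳ-≤ (ρ X) ρY≤ρZ ⟩
    ρ X + ρ Z              ∎)
    where open ≤-Reasoning

  flat-absorbs : ∀ {Y Z W} → IsFlat M Y → Z ⊆ Y → ρ (Z ∪ W) ≤ ρ Z → W ⊆ Y
  flat-absorbs {Y} {Z} {W} flatY Z⊆Y ρZ∪W≤ρZ {e} e∈W with e ∈? Y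
  ... | yes e∈Y = e∈Y
  ... | no e∉Y = ⊥-elim (<⇒≱ (flatY e e∉Y) (begin
    ρ (Y ∪ ⁅ e ⁆)        ≤⟨ r-mono M (∪-lub (p⊆p∪q _) (⊆-trans (x∈p⇒⁅x⁆⊆p (q⊆p∪q Z W e∈W)) (q⊆p∪q Y _))) ⟩
    ρ (Y ∪ (Z ∪ W))      ≤⟨ ρ-absorb Z⊆Y (p⊆p∪q W) ρZ∪W≤ρZ ⟩
    ρ Y                  ∎))
    where open ≤-Reasoning

  flat-grows : ∀ {Y Z e} → IsFlat M Y → Z ⊆ Y → e ∉ Y → ρ Z < ρ (Z ∪ ⁅ e ⁆)
  flat-grows {Y} {Z} {e} flatY Z⊆Y e∉Y with ρ (Z ∪ ⁅ e ⁆) ≤? ρ Z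
  ... | yes ρZ+e≤ρZ = ⊥-elim (e∉Y (flat-absorbs flatY Z⊆Y ρZ+e≤ρZ (x∈⁅x⁆ e)))
  ... | no ρZ+e≰ρZ = ≰⇒> ρZ+e≰ρZ

  ρ-∩-flat-≥⇒⊆ : ∀ {W Y} → IsFlat M Y → ρ W ≤ ρ (W ∩ Y) → W ⊆ Y
  ρ-∩-flat-≥⇒⊆ {W} {Y} flatY ρW≤ρW∩Y =
    flat-absorbs flatY (p∩q⊆q W Y) (≤-trans (r-mono M (∪-lub (p∩q⊆p W Y) ⊆-refl)) ρW≤ρW∩Y)

  ρ-∩-flat-< : ∀ {X Y e} → IsFlat M Y → e ∈ X → e ∉ Y → ρ (X ∩ Y) < ρ X
  ρ-∩-flat-< {X} {Y} flatY e∈X e∉Y = ≰⇒> λ ρX≤ρX∩Y → e∉Y (ρ-∩-flat-≥⇒⊆ flatY ρX≤ρX∩Y e∈X)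

  ∩-flat : ∀ {X Y} → IsFlat M X → IsFlat M Y → IsFlat M (X ∩ Y)
  ∩-flat {X} {Y} flatX flatY e e∉X∩Y with e ∈? X
  ... | yes e∈X = flat-grows flatY (p∩q⊆q X Y) (λ e∈Y → e∉X∩Y (x∈p∩q⁺ (e∈X , e∈Y)))
  ... | no e∉X = flat-grows flatX (p∩q⊆p X Y) e∉X

  flat-⊆-≡ : ∀ {X Y} → IsFlat M X → X ⊆ Y → ρ Y ≤ ρ X → X ≡ Y
  flat-⊆-≡ {X} {Y} flatX X⊆Y ρY≤ρX = ⊆-antisym X⊆Y
    (flat-absorbs flatX ⊆-refl (≤-trans (r-mono M (∪-lub X⊆Y ⊆-refl)) ρY≤ρX))

  ρ-spanned : ∀ Z W → (∀ {e} → e ∈ W → ρ (Z ∪ ⁅ e ⁆) ≤ ρ Z) → ρ (Z ∪ W) ≤ ρ Z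
  ρ-spanned Z W = go ∣ W ∣ W ≤-refl
    where
    go : ∀ k W → ∣ W ∣ ≤ k → (∀ {e} → e ∈ W → ρ (Z ∪ ⁅ e ⁆) ≤ ρ Z) → ρ (Z ∪ W) ≤ ρ Z
    go k W _ _ with nonempty? W
    go k W _ _ | no empty = r-mono M (∪-lub ⊆-refl λ x∈W → ⊥-elim (empty (_ , x∈W)))
    go zero W ∣W∣≤0 _ | yes (e , e∈W) = ⊥-elim (n≮0 (<-≤-trans (x∈p⇒∣p-x∣<∣p∣ e∈W) ∣W∣≤0))
    go (suc k) W ∣W∣≤1+k spanned | yes (e , e∈W) = begin
      ρ (Z ∪ W)                          ≤⟨ r-mono M (∪-lub (⊆-trans (p⊆p∪q _) (p⊆p∪q _)) split) ⟩
      ρ ((Z ∪ (W - e)) ∪ (Z ∪ ⁅ e ⁆))    ≤⟨ ρ-absorb (p⊆p∪q _) (p⊆p∪q _) (spanned e∈W) ⟩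
      ρ (Z ∪ (W - e))                    ≤⟨ go k (W - e) (≤-pred (<-≤-trans (x∈p⇒∣p-x∣<∣p∣ e∈W) ∣W∣≤1+k))
                                               (λ x∈ → spanned (p─q⊆p W ⁅ e ⁆ x∈)) ⟩
      ρ Z                                ∎
      where
      open ≤-Reasoning
      split : W ⊆ (Z ∪ (W - e)) ∪ (Z ∪ ⁅ e ⁆)
      split x∈W = [ (λ x∈e → q⊆p∪q _ _ (q⊆p∪q Z _ x∈e)) , (λ x∈W-e → p⊆p∪q _ (q⊆p∪q Z _ x∈W-e)) ]
                    (x∈q⊎x∈p─q x∈W)

  ∃-ρ-increasing : ∀ Z W → ρ Z < ρ (Z ∪ W) → ∃ λ e → e ∈ W × ρ Z < ρ (Z ∪ ⁅ e ⁆)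
  ∃-ρ-increasing Z W ρZ<ρZ∪W with any? (λ e → (e ∈? W) ×-dec (ρ Z <? ρ (Z ∪ ⁅ e ⁆)))
  ... | yes witness = witness
  ... | no none = ⊥-elim (<⇒≱ ρZ<ρZ∪W (ρ-spanned Z W λ {e} e∈W → ≮⇒≥ λ ρZ<ρZ+e → none (e , e∈W , ρZ<ρZ+e)))

  abstract
    cl : Subset m → Subset m
    cl Z = tabulate λ e → does (ρ (Z ∪ ⁅ e ⁆) ≤? ρ Z)

    ∈-cl⁻ : ∀ {Z e} → e ∈ cl Z → ρ (Z ∪ ⁅ e ⁆) ≤ ρ Z
    ∈-cl⁻ {Z} {e} e∈clZ = spanned (ρ (Z ∪ ⁅ e ⁆) ≤? ρ Z)
      (trans (sym (lookup∘tabulate _ e)) ([]=⇒lookup e∈clZ))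
      where
      spanned : (d : Dec (ρ (Z ∪ ⁅ e ⁆) ≤ ρ Z)) → does d ≡ inside → ρ (Z ∪ ⁅ e ⁆) ≤ ρ Z
      spanned (yes ρZ+e≤ρZ) _ = ρZ+e≤ρZ

    ∈-cl⁺ : ∀ {Z e} → ρ (Z ∪ ⁅ e ⁆) ≤ ρ Z → e ∈ cl Z
    ∈-cl⁺ {Z} {e} ρZ+e≤ρZ = lookup⇒[]= e (cl Z)
      (trans (lookup∘tabulate _ e) (decided (ρ (Z ∪ ⁅ e ⁆) ≤? ρ Z)))
      where
      decided : (d : Dec (ρ (Z ∪ ⁅ e ⁆) ≤ ρ Z)) → does d ≡ inside
      decided (yes _) = refl
      decided (no ρZ+e≰ρZ) = ⊥-elim (ρZ+e≰ρZ ρZ+e≤ρZ)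

  ⊆-cl : ∀ {Z} → Z ⊆ cl Z
  ⊆-cl e∈Z = ∈-cl⁺ (r-mono M (∪-lub ⊆-refl (x∈p⇒⁅x⁆⊆p e∈Z)))

  ρ-cl : ∀ Z → ρ (cl Z) ≡ ρ Z
  ρ-cl Z = ≤-antisym (≤-trans (r-mono M (q⊆p∪q Z (cl Z))) (ρ-spanned Z (cl Z) ∈-cl⁻)) (r-mono M ⊆-cl)

  cl-flat : ∀ Z → IsFlat M (cl Z)
  cl-flat Z e e∉clZ = begin-strict
    ρ (cl Z)          ≡⟨ ρ-cl Z ⟩
    ρ Z               <⟨ ≰⇒> (λ ρZ+e≤ρZ → e∉clZ (∈-cl⁺ ρZ+e≤ρZ)) ⟩
    ρ (Z ∪ ⁅ e ⁆)     ≤⟨ r-mono M (∪-lub (⊆-trans ⊆-cl (p⊆p∪q _)) (q⊆p∪q _ _)) ⟩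
    ρ (cl Z ∪ ⁅ e ⁆)  ∎
    where open ≤-Reasoning

  flat? : ∀ X → Dec (IsFlat M X)
  flat? X = all? λ e → ¬? (e ∈? X) →-dec (ρ X <? ρ (X ∪ ⁅ e ⁆))

  ¬modular⇒∃nonmodular : ¬ IsModular M → ∃ λ X → ∃ λ Y → IsFlat M X × IsFlat M Y × NonModularPair X Y
  ¬modular⇒∃nonmodular ¬modular with anySubset? (λ X → anySubset? λ Y →
    flat? X ×-dec flat? Y ×-dec (ρ (X ∪ Y) + ρ (X ∩ Y) <? ρ X + ρ Y))
  ... | yes witness = witness
  ... | no none = ⊥-elim (¬modular λ X Y flatX flatY → ≤-antisym (r-submod M X Y)
          (≮⇒≥ λ nonmodular → none (X , Y , flatX , flatY , nonmodular)))

  module Separation (S T : Subset m) (covers : ∀ e → e ∈ S ⊎ e ∈ T) (separates : ρ S + ρ T ≤ ρ ⊤) where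

    ρ-side-∪ : ∀ X → ρ S + ρ (X ∩ T) ≤ ρ (X ∪ S)
    ρ-side-∪ X = +-cancelʳ-≤ (ρ T) _ _ (begin
      (ρ S + ρ (X ∩ T)) + ρ T              ≡⟨ xy∙z≈xz∙y (ρ S) _ _ ⟩
      (ρ S + ρ T) + ρ (X ∩ T)              ≤⟨ +-mono-≤ (≤-trans separates (r-mono M ⊤⊆)) (r-mono M X∩T⊆) ⟩
      ρ ((X ∪ S) ∪ T) + ρ ((X ∪ S) ∩ T)    ≤⟨ r-submod M (X ∪ S) T ⟩
      ρ (X ∪ S) + ρ T                      ∎)
      where
      open ≤-Reasoning
      ⊤⊆ : ⊤ ⊆ (X ∪ S) ∪ T
      ⊤⊆ {e} _ = [ (λ e∈S → p⊆p∪q T (q⊆p∪q X S e∈S)) , q⊆p∪q _ T ] (covers e)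
      X∩T⊆ : X ∩ T ⊆ (X ∪ S) ∩ T
      X∩T⊆ = ⊆-∩ (⊆-trans (p∩q⊆p X T) (p⊆p∪q S)) (p∩q⊆q X T)

    ρ-split : ∀ Z → ρ (Z ∩ S) + ρ (Z ∩ T) ≤ ρ Z
    ρ-split Z = +-cancelʳ-≤ (ρ S) _ _ (begin
      (ρ (Z ∩ S) + ρ (Z ∩ T)) + ρ S    ≡⟨ xy∙z≈x∙zy (ρ (Z ∩ S)) _ _ ⟩
      ρ (Z ∩ S) + (ρ S + ρ (Z ∩ T))    ≤⟨ +-monoʳ-≤ (ρ (Z ∩ S)) (ρ-side-∪ Z) ⟩
      ρ (Z ∩ S) + ρ (Z ∪ S)            ≡⟨ +-comm (ρ (Z ∩ S)) _ ⟩
      ρ (Z ∪ S) + ρ (Z ∩ S)            ≤⟨ r-submod M Z S ⟩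
      ρ Z + ρ S                        ∎)
      where open ≤-Reasoning

    ρ-split-≥ : ∀ Z → ρ Z ≤ ρ (Z ∩ S) + ρ (Z ∩ T)
    ρ-split-≥ Z = ≤-trans (r-mono M (p⊆q∪r⇒p⊆p∩q∪p∩r λ {e} _ → x∈p∪q⁺ (covers e))) (ρ-∪ (Z ∩ S) (Z ∩ T))

    ρ-∩-∪ : ∀ X → ρ (X ∩ S) + ρ T ≤ ρ ((X ∩ S) ∪ T)
    ρ-∩-∪ X = ≤-trans
      (+-mono-≤ (r-mono M (⊆-∩ (p⊆p∪q T) (p∩q⊆q X S))) (r-mono M (⊆-∩ (q⊆p∪q _ T) ⊆-refl)))
      (ρ-split ((X ∩ S) ∪ T))

    flat-∩-∪ : ∀ {X} → IsFlat M X → IsFlat M ((X ∩ S) ∪ T)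
    flat-∩-∪ {X} flatX e e∉P = begin-strict
      ρ ((X ∩ S) ∪ T)                          ≤⟨ ρ-∪ (X ∩ S) T ⟩
      ρ (X ∩ S) + ρ T                          <⟨ +-monoˡ-< (ρ T) ρX∩S-grows ⟩
      ρ ((X ∩ S) ∪ ⁅ e ⁆) + ρ T                ≤⟨ ≤-trans (+-mono-≤ (r-mono M ⊆P+e∩S) (r-mono M ⊆P+e∩T))
                                                    (ρ-split (((X ∩ S) ∪ T) ∪ ⁅ e ⁆)) ⟩
      ρ (((X ∩ S) ∪ T) ∪ ⁅ e ⁆)                ∎
      where
      open ≤-Reasoning
      e∈S : e ∈ S
      e∈S = [ (λ e∈S → e∈S) , (λ e∈T → ⊥-elim (e∉P (q⊆p∪q _ T e∈T))) ] (covers e)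
      e∉X : e ∉ X
      e∉X e∈X = e∉P (p⊆p∪q T (x∈p∩q⁺ (e∈X , e∈S)))
      X+e⊆ : X ∪ ⁅ e ⁆ ⊆ ((X ∩ S) ∪ ⁅ e ⁆) ∪ (X ∩ T)
      X+e⊆ = ∪-lub (λ {x} x∈X → [ (λ x∈S → p⊆p∪q _ (p⊆p∪q _ (x∈p∩q⁺ (x∈X , x∈S))))
                                 , (λ x∈T → q⊆p∪q _ _ (x∈p∩q⁺ (x∈X , x∈T))) ] (covers x))
                   (⊆-trans (q⊆p∪q _ _) (p⊆p∪q _))
      ρX∩S-grows : ρ (X ∩ S) < ρ ((X ∩ S) ∪ ⁅ e ⁆)
      ρX∩S-grows = +-cancelʳ-< (ρ (X ∩ T)) _ _ (≤-<-trans (ρ-split X)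
        (<-≤-trans (flatX e e∉X) (≤-trans (r-mono M X+e⊆) (ρ-∪ _ _))))
      ⊆P+e∩S : (X ∩ S) ∪ ⁅ e ⁆ ⊆ (((X ∩ S) ∪ T) ∪ ⁅ e ⁆) ∩ S
      ⊆P+e∩S = ⊆-∩ (∪-lub (⊆-trans (p⊆p∪q T) (p⊆p∪q _)) (q⊆p∪q _ _))
                   (∪-lub (p∩q⊆q X S) (x∈p⇒⁅x⁆⊆p e∈S))
      ⊆P+e∩T : T ⊆ (((X ∩ S) ∪ T) ∪ ⁅ e ⁆) ∩ T
      ⊆P+e∩T = ⊆-∩ (⊆-trans (q⊆p∪q _ T) (p⊆p∪q _)) ⊆-refl

    nonmodular-∩-∪ : ∀ {X Y} → NonModularPair (X ∩ S) (Y ∩ S) →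
                     NonModularPair ((X ∩ S) ∪ T) ((Y ∩ S) ∪ T)
    nonmodular-∩-∪ {X} {Y} nonmodular = begin-strict
      ρ (P ∪ Q) + ρ (P ∩ Q)                               ≤⟨ +-mono-≤ (≤-trans (r-mono M P∪Q⊆) (ρ-∪ _ T))
                                                                        (≤-trans (r-mono M P∩Q⊆) (ρ-∪ _ T)) ⟩
      (ρ (XS ∪ YS) + ρ T) + (ρ (XS ∩ YS) + ρ T)           ≡⟨ interchange (ρ (XS ∪ YS)) _ _ _ ⟩
      (ρ (XS ∪ YS) + ρ (XS ∩ YS)) + (ρ T + ρ T)           <⟨ +-monoˡ-< (ρ T + ρ T) nonmodular ⟩
      (ρ XS + ρ YS) + (ρ T + ρ T)                         ≡⟨ interchange (ρ XS) _ _ _ ⟩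
      (ρ XS + ρ T) + (ρ YS + ρ T)                         ≤⟨ +-mono-≤ (ρ-∩-∪ X) (ρ-∩-∪ Y) ⟩
      ρ P + ρ Q                                           ∎
      where
      open ≤-Reasoning
      XS = X ∩ S
      YS = Y ∩ S
      P = XS ∪ T
      Q = YS ∪ T
      P∪Q⊆ : P ∪ Q ⊆ (XS ∪ YS) ∪ T
      P∪Q⊆ = ∪-lub (∪-lub (⊆-trans (p⊆p∪q YS) (p⊆p∪q T)) (q⊆p∪q _ T))
                   (∪-lub (⊆-trans (q⊆p∪q XS YS) (p⊆p∪q T)) (q⊆p∪q _ T))
      P∩Q⊆ : P ∩ Q ⊆ (XS ∩ YS) ∪ T
      P∩Q⊆ {x} x∈P∩Q with x∈p∩q⁻ P Q x∈P∩Q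
      ... | x∈P , x∈Q with x∈p∪q⁻ XS T x∈P | x∈p∪q⁻ YS T x∈Q
      ...   | inj₁ x∈XS | inj₁ x∈YS = p⊆p∪q T (x∈p∩q⁺ (x∈XS , x∈YS))
      ...   | inj₂ x∈T  | _         = q⊆p∪q _ T x∈T
      ...   | _         | inj₂ x∈T  = q⊆p∪q _ T x∈T

    nonmodular-splits : ∀ {X Y} → NonModularPair X Y →
                        NonModularPair (X ∩ S) (Y ∩ S) ⊎ NonModularPair (X ∩ T) (Y ∩ T)
    nonmodular-splits {X} {Y} nonmodular = decide (joinMeetS <? rankS)
      where
      open ≤-Reasoning
      joinMeetS = ρ ((X ∩ S) ∪ (Y ∩ S)) + ρ ((X ∩ S) ∩ (Y ∩ S))
      joinMeetT = ρ ((X ∩ T) ∪ (Y ∩ T)) + ρ ((X ∩ T) ∩ (Y ∩ T))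
      rankS = ρ (X ∩ S) + ρ (Y ∩ S)
      rankT = ρ (X ∩ T) + ρ (Y ∩ T)
      ∪-∩⊆ : ∀ {W} → (X ∩ W) ∪ (Y ∩ W) ⊆ (X ∪ Y) ∩ W
      ∪-∩⊆ {W} = ∪-lub (⊆-∩ (⊆-trans (p∩q⊆p X W) (p⊆p∪q Y)) (p∩q⊆q X W))
                       (⊆-∩ (⊆-trans (p∩q⊆p Y W) (q⊆p∪q X Y)) (p∩q⊆q Y W))
      ∩-∩⊆ : ∀ {W} → (X ∩ W) ∩ (Y ∩ W) ⊆ (X ∩ Y) ∩ W
      ∩-∩⊆ {W} = ⊆-∩ (⊆-∩ (⊆-trans (p∩q⊆p _ _) (p∩q⊆p X W)) (⊆-trans (p∩q⊆q _ _) (p∩q⊆p Y W)))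
                     (⊆-trans (p∩q⊆p _ _) (p∩q⊆q X W))
      total-≤ : joinMeetS + joinMeetT ≤ ρ (X ∪ Y) + ρ (X ∩ Y)
      total-≤ = begin
        joinMeetS + joinMeetT   ≡⟨ interchange (ρ ((X ∩ S) ∪ (Y ∩ S))) _ _ _ ⟩
        _                       ≤⟨ +-mono-≤ (≤-trans (+-mono-≤ (r-mono M ∪-∩⊆) (r-mono M ∪-∩⊆)) (ρ-split (X ∪ Y)))
                                            (≤-trans (+-mono-≤ (r-mono M ∩-∩⊆) (r-mono M ∩-∩⊆)) (ρ-split (X ∩ Y))) ⟩
        ρ (X ∪ Y) + ρ (X ∩ Y)   ∎
      decide : Dec (joinMeetS < rankS) → NonModularPair (X ∩ S) (Y ∩ S) ⊎ NonModularPair (X ∩ T) (Y ∩ T)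
      decide (yes nonmodularS) = inj₁ nonmodularS
      decide (no modularS) = inj₂ (+-cancelˡ-< joinMeetS _ _ (begin-strict
        joinMeetS + joinMeetT  ≤⟨ total-≤ ⟩
        ρ (X ∪ Y) + ρ (X ∩ Y)  <⟨ nonmodular ⟩
        ρ X + ρ Y              ≤⟨ ≤-trans (+-mono-≤ (ρ-split-≥ X) (ρ-split-≥ Y))
                                    (≤-reflexive (interchange (ρ (X ∩ S)) _ _ _)) ⟩
        rankS + rankT          ≤⟨ +-monoˡ-≤ rankT (≮⇒≥ modularS) ⟩
        joinMeetS + rankT      ∎))

module LooplessProperties {m : ℕ} (M : Matroid m) (loopless : Loopless M) where

  open MatroidProperties M public

  ∈⇒ρ≥1 : ∀ {X e} → e ∈ X → 1 ≤ ρ X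
  ∈⇒ρ≥1 {X} {e} e∈X = ≤-trans (≤-reflexive (sym (loopless e))) (r-mono M (x∈p⇒⁅x⁆⊆p e∈X))

  ρ-∪⁅⁆≤ : ∀ X e → ρ (X ∪ ⁅ e ⁆) ≤ suc (ρ X)
  ρ-∪⁅⁆≤ X e = ≤-trans (ρ-∪ X ⁅ e ⁆) (≤-reflexive (trans (cong (ρ X +_) (loopless e)) (+-comm (ρ X) 1)))

  ρ-∪⁅⁆-outside-flat : ∀ {Y Z e} → IsFlat M Y → Z ⊆ Y → e ∉ Y → ρ (Z ∪ ⁅ e ⁆) ≡ suc (ρ Z)
  ρ-∪⁅⁆-outside-flat {Z = Z} {e} flatY Z⊆Y e∉Y = ≤-antisym (ρ-∪⁅⁆≤ Z e) (flat-grows flatY Z⊆Y e∉Y)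

  pair : Fin m → Fin m → Subset m
  pair a b = ⁅ a ⁆ ∪ ⁅ b ⁆

  pair-⊆ : ∀ {a b Z} → a ∈ Z → b ∈ Z → pair a b ⊆ Z
  pair-⊆ a∈Z b∈Z = ∪-lub (x∈p⇒⁅x⁆⊆p a∈Z) (x∈p⇒⁅x⁆⊆p b∈Z)

  triple : Fin m → Fin m → Fin m → Subset m
  triple a b c = pair a b ∪ ⁅ c ⁆

  module _ {a b c : Fin m} where

    ∈triple₁ : a ∈ triple a b c
    ∈triple₁ = p⊆p∪q _ (p⊆p∪q _ (x∈⁅x⁆ a))

    ∈triple₂ : b ∈ triple a b c
    ∈triple₂ = p⊆p∪q _ (q⊆p∪q _ _ (x∈⁅x⁆ b))

    ∈triple₃ : c ∈ triple a b c
    ∈triple₃ = q⊆p∪q _ _ (x∈⁅x⁆ c)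

    triple-⊆ : ∀ {Z} → a ∈ Z → b ∈ Z → c ∈ Z → triple a b c ⊆ Z
    triple-⊆ a∈Z b∈Z c∈Z = ∪-lub (pair-⊆ a∈Z b∈Z) (x∈p⇒⁅x⁆⊆p c∈Z)

  ρ-pair-outside-flat : ∀ {Y a b} → IsFlat M Y → a ∈ Y → b ∉ Y → ρ (pair a b) ≡ 2
  ρ-pair-outside-flat {a = a} flatY a∈Y b∉Y =
    trans (ρ-∪⁅⁆-outside-flat flatY (x∈p⇒⁅x⁆⊆p a∈Y) b∉Y) (cong suc (loopless a))

  ρ-∪-concurrent : ∀ {U V x} → ρ U ≤ 1 → ρ V ≤ 1 → x ∈ U → x ∈ V → ρ (U ∪ V) ≤ 1
  ρ-∪-concurrent {U} {V} ρU≤1 ρV≤1 x∈U x∈V = +-cancelʳ-≤ 1 _ _ (begin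
    ρ (U ∪ V) + 1          ≤⟨ +-monoʳ-≤ (ρ (U ∪ V)) (∈⇒ρ≥1 (x∈p∩q⁺ (x∈U , x∈V))) ⟩
    ρ (U ∪ V) + ρ (U ∩ V)  ≤⟨ r-submod M U V ⟩
    ρ U + ρ V              ≤⟨ +-mono-≤ ρU≤1 ρV≤1 ⟩
    1 + 1                  ∎)
    where open ≤-Reasoning

  ∃-avoiding : ∀ {W X Y x} → 2 ≤ ρ W → ρ (W ∩ X) ≤ 1 → ρ (W ∩ Y) ≤ 1 →
               x ∈ W ∩ X → x ∈ W ∩ Y → ∃ λ c → c ∈ W × c ∉ X × c ∉ Y
  ∃-avoiding {W} {X} {Y} 2≤ρW ρW∩X≤1 ρW∩Y≤1 x∈W∩X x∈W∩Y
    with any? (λ c → (c ∈? W) ×-dec ¬? (c ∈? X) ×-dec ¬? (c ∈? Y))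
  ... | yes witness = witness
  ... | no none = ⊥-elim (<⇒≱ 2≤ρW (≤-trans (r-mono M W⊆) (ρ-∪-concurrent ρW∩X≤1 ρW∩Y≤1 x∈W∩X x∈W∩Y)))
    where
    W⊆ : W ⊆ (W ∩ X) ∪ (W ∩ Y)
    W⊆ {c} c∈W with c ∈? X | c ∈? Y
    ... | yes c∈X | _       = p⊆p∪q _ (x∈p∩q⁺ (c∈W , c∈X))
    ... | no _    | yes c∈Y = q⊆p∪q _ _ (x∈p∩q⁺ (c∈W , c∈Y))
    ... | no c∉X  | no c∉Y  = ⊥-elim (none (c , c∈W , c∉X , c∉Y))

  ∃-third-point : ∀ {K x a} → Line K → x ∉ K → a ∈ K → ∃ λ a′ → a′ ∈ K × 3 ≤ ρ (triple a x a′)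
  ∃-third-point {K} {x} {a} (flatK , ρK≡2) x∉K a∈K
    with ∃-ρ-increasing (pair a x) K (begin-strict
      ρ (pair a x)       ≡⟨ ρ-pair-outside-flat flatK a∈K x∉K ⟩
      2                  <⟨ ≤-refl ⟩
      3                  ≡⟨ trans (cong suc (sym ρK≡2)) (sym (ρ-∪⁅⁆-outside-flat flatK ⊆-refl x∉K)) ⟩
      ρ (K ∪ ⁅ x ⁆)      ≤⟨ r-mono M (∪-lub (q⊆p∪q _ K) (⊆-trans (q⊆p∪q ⁅ a ⁆ _) (p⊆p∪q K))) ⟩
      ρ (pair a x ∪ K)   ∎)
    where open ≤-Reasoning
  ... | a′ , a′∈K , ρ<ρ+a′ = a′ , a′∈K ,
          subst (λ k → k < ρ (pair a x ∪ ⁅ a′ ⁆)) (ρ-pair-outside-flat flatK a∈K x∉K) ρ<ρ+a′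

  line-⊇-side : ∀ {S T Z} → ρ S ≤ 1 → ρ T ≤ 2 → Z ⊆ S ∪ T → Line Z → S ⊆ Z ⊎ T ⊆ Z
  line-⊇-side {S} {T} {Z} ρS≤1 ρT≤2 Z⊆S∪T (flatZ , ρZ≡2) with nonempty? (S ∩ Z)
  ... | yes (_ , e∈S∩Z) = inj₁ (ρ-∩-flat-≥⇒⊆ flatZ (≤-trans ρS≤1 (∈⇒ρ≥1 e∈S∩Z)))
  ... | no S∩Z-empty = inj₂ (ρ-∩-flat-≥⇒⊆ flatZ (begin
    ρ T                        ≤⟨ ρT≤2 ⟩
    2                          ≡⟨ sym ρZ≡2 ⟩
    ρ Z                        ≤⟨ r-mono M (p⊆q∪r⇒p⊆p∩q∪p∩r Z⊆S∪T) ⟩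
    ρ ((Z ∩ S) ∪ (Z ∩ T))      ≤⟨ ρ-∪ (Z ∩ S) (Z ∩ T) ⟩
    ρ (Z ∩ S) + ρ (Z ∩ T)      ≤⟨ +-monoˡ-≤ (ρ (Z ∩ T))
                                    (≤-trans (r-mono M (⊆-reflexive (∩-comm Z S))) (≤-reflexive (ρ-empty S∩Z-empty))) ⟩
    ρ (Z ∩ T)                  ≡⟨ cong ρ (∩-comm Z T) ⟩
    ρ (T ∩ Z)                  ∎))
    where open ≤-Reasoning

  no-disjoint-lines-across : ∀ {S T Z₁ Z₂} → ρ S ≤ 1 → ρ T ≤ 2 → Nonempty S → Nonempty T →
                             Line Z₁ → Line Z₂ → Z₁ ⊆ S ∪ T → Z₂ ⊆ S ∪ T → Empty (Z₁ ∩ Z₂) → ⊥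
  no-disjoint-lines-across {S} {T} ρS≤1 ρT≤2 (s , s∈S) (t , t∈T) line₁ line₂ Z₁⊆S∪T Z₂⊆S∪T disjoint
    with line-⊇-side ρS≤1 ρT≤2 Z₁⊆S∪T line₁ | line-⊇-side ρS≤1 ρT≤2 Z₂⊆S∪T line₂
  ... | inj₁ S⊆Z₁ | inj₁ S⊆Z₂ = disjoint (s , x∈p∩q⁺ (S⊆Z₁ s∈S , S⊆Z₂ s∈S))
  ... | inj₂ T⊆Z₁ | inj₂ T⊆Z₂ = disjoint (t , x∈p∩q⁺ (T⊆Z₁ t∈T , T⊆Z₂ t∈T))
  ... | inj₁ _    | inj₂ T⊆Z₂ = <⇒≱ (s≤s ρS≤1) (≤-trans (≤-reflexive (sym (proj₂ line₁)))
          (r-mono M (p⊆q∪r⇒p⊆q Z₁⊆S∪T λ e∈Z₁ e∈T → disjoint (_ , x∈p∩q⁺ (e∈Z₁ , T⊆Z₂ e∈T)))))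
  ... | inj₂ T⊆Z₁ | inj₁ _    = <⇒≱ (s≤s ρS≤1) (≤-trans (≤-reflexive (sym (proj₂ line₂)))
          (r-mono M (p⊆q∪r⇒p⊆q Z₂⊆S∪T λ e∈Z₂ e∈T → disjoint (_ , x∈p∩q⁺ (T⊆Z₁ e∈T , e∈Z₂)))))

  inseparable-with-disjoint-lines : ∀ {P Z₁ Z₂} → ρ P ≡ 3 → Line Z₁ → Line Z₂ → Z₁ ⊆ P → Z₂ ⊆ P →
                                    Empty (Z₁ ∩ Z₂) → InseparableSet M P
  inseparable-with-disjoint-lines {P} ρP≡3 line₁ line₂ Z₁⊆P Z₂⊆P disjoint
                                  S (S⊆P , separates) S-nonempty S≢P =
    [ (λ ρS≤1 → no-disjoint-lines-across ρS≤1 (≤2 ρS+ρT≡3 S-nonempty) S-nonempty T-nonempty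
                  line₁ line₂ (⊆S∪T Z₁⊆P) (⊆S∪T Z₂⊆P) disjoint)
    , (λ ρT≤1 → no-disjoint-lines-across ρT≤1 (≤2 (trans (+-comm (ρ T) (ρ S)) ρS+ρT≡3) T-nonempty)
                  T-nonempty S-nonempty line₁ line₂ (⊆T∪S Z₁⊆P) (⊆T∪S Z₂⊆P) disjoint)
    ] one-side-≤1
    where
    T = P ─ S
    ρS+ρT≡3 : ρ S + ρ T ≡ 3
    ρS+ρT≡3 = trans separates ρP≡3
    T-nonempty : Nonempty T
    T-nonempty with p⊈q⇒∃ (λ P⊆S → S≢P (⊆-antisym S⊆P P⊆S))
    ... | x , x∈P , x∉S = x , x∈p∧x∉q⇒x∈p─q x∈P x∉S
    ⊆S∪T : ∀ {Z} → Z ⊆ P → Z ⊆ S ∪ T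
    ⊆S∪T Z⊆P x∈Z = x∈p∪q⁺ (x∈q⊎x∈p─q (Z⊆P x∈Z))
    ⊆T∪S : ∀ {Z} → Z ⊆ P → Z ⊆ T ∪ S
    ⊆T∪S Z⊆P x∈Z = x∈p∪q⁺ (swap (x∈q⊎x∈p─q (Z⊆P x∈Z)))
    ≤2 : ∀ {X Y} → ρ X + ρ Y ≡ 3 → Nonempty X → ρ Y ≤ 2
    ≤2 {X} {Y} ρX+ρY≡3 (_ , x∈X) =
      +-cancelˡ-≤ 1 (ρ Y) 2 (≤-trans (+-monoˡ-≤ (ρ Y) (∈⇒ρ≥1 x∈X)) (≤-reflexive ρX+ρY≡3))
    one-side-≤1 : ρ S ≤ 1 ⊎ ρ T ≤ 1
    one-side-≤1 with ρ S ≤? 1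
    ... | yes ρS≤1 = inj₁ ρS≤1
    ... | no ρS≰1 = inj₂ (+-cancelˡ-≤ 2 (ρ T) 1 (≤-trans (+-monoˡ-≤ (ρ T) (≰⇒> ρS≰1)) (≤-reflexive ρS+ρT≡3)))

module HypermodularProperties {m : ℕ} (M : Matroid m) (loopless : Loopless M) (hypermodular : Hypermodular M)
  where

  open LooplessProperties M loopless public

  ρ≤4 : ∀ X → ρ X ≤ 4
  ρ≤4 X = ≤-trans (r-mono M ⊆⊤) (≤-reflexive (proj₁ hypermodular))

  planes-meet-in-line : ∀ {P Q e} → Plane P → Plane Q → e ∈ P → e ∉ Q → ρ (P ∩ Q) ≡ 2
  planes-meet-in-line {P} {Q} {e} (flatP , ρP≡3) (flatQ , ρQ≡3) e∈P e∉Q =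
    +-cancelˡ-≡ 4 (ρ (P ∩ Q)) 2 (begin
      4 + ρ (P ∩ Q)          ≡⟨ cong (_+ ρ (P ∩ Q)) (sym ρP∪Q≡4) ⟩
      ρ (P ∪ Q) + ρ (P ∩ Q)  ≡⟨ proj₂ hypermodular P Q flatP flatQ ρP≡3 ρQ≡3 ⟩
      ρ P + ρ Q              ≡⟨ cong₂ _+_ ρP≡3 ρQ≡3 ⟩
      6                      ∎)
    where
    open ≡-Reasoning
    ρP∪Q≡4 : ρ (P ∪ Q) ≡ 4
    ρP∪Q≡4 = ≤-antisym (ρ≤4 (P ∪ Q)) (≤-trans (≤-reflexive (cong suc (sym ρQ≡3)))
      (≤-trans (flat-grows flatQ ⊆-refl e∉Q) (r-mono M (∪-lub (q⊆p∪q P Q) (⊆-trans (x∈p⇒⁅x⁆⊆p e∈P) (p⊆p∪q Q))))))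

  planes-meet-in : ∀ {P Q K e} → Plane P → Plane Q → Line K → K ⊆ P → K ⊆ Q → e ∈ P → e ∉ Q → P ∩ Q ⊆ K
  planes-meet-in planeP planeQ (flatK , ρK≡2) K⊆P K⊆Q e∈P e∉Q = ⊆-reflexive (sym
    (flat-⊆-≡ flatK (⊆-∩ K⊆P K⊆Q) (≤-reflexive (trans (planes-meet-in-line planeP planeQ e∈P e∉Q) (sym ρK≡2)))))

  ρ-⊆-planes-meet : ∀ {P Q Z e} → Plane P → Plane Q → e ∈ P → e ∉ Q → Z ⊆ P ∩ Q → ρ Z ≤ 2
  ρ-⊆-planes-meet planeP planeQ e∈P e∉Q Z⊆P∩Q =
    ≤-trans (r-mono M Z⊆P∩Q) (≤-reflexive (planes-meet-in-line planeP planeQ e∈P e∉Q))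

  ⊆-line-∩-flat⇒ρ≤1 : ∀ {L P W e} → ρ L ≡ 2 → IsFlat M P → e ∈ L → e ∉ P → W ⊆ L ∩ P → ρ W ≤ 1
  ⊆-line-∩-flat⇒ρ≤1 ρL≡2 flatP e∈L e∉P W⊆L∩P =
    ≤-pred (≤-trans (s≤s (r-mono M W⊆L∩P)) (≤-trans (ρ-∩-flat-< flatP e∈L e∉P) (≤-reflexive ρL≡2)))

  cl-plane : ∀ {Y Z e} → IsFlat M Y → Z ⊆ Y → ρ Z ≡ 2 → e ∉ Y → Plane (cl (Z ∪ ⁅ e ⁆))
  cl-plane {Z = Z} {e} flatY Z⊆Y ρZ≡2 e∉Y =
    cl-flat _ , trans (ρ-cl _) (trans (ρ-∪⁅⁆-outside-flat flatY Z⊆Y e∉Y) (cong suc ρZ≡2))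

  meeting-flats-modular : ∀ {P Q} → IsFlat M P → IsFlat M Q → Nonempty (P ∩ Q) → ¬ NonModularPair P Q
  meeting-flats-modular {P} {Q} flatP flatQ (_ , x∈P∩Q) nonmodular
    with ρ (P ∪ Q) ≤? ρ P | ρ (P ∪ Q) ≤? ρ Q
  ... | yes ρP∪Q≤ρP | _ = <⇒≱ nonmodular (+-mono-≤ (r-mono M (p⊆p∪q Q))
          (r-mono M (⊆-∩ (flat-absorbs flatP ⊆-refl ρP∪Q≤ρP) ⊆-refl)))
  ... | _ | yes ρP∪Q≤ρQ = <⇒≱ nonmodular (≤-trans (≤-reflexive (+-comm (ρ P) (ρ Q))) (+-mono-≤
          (r-mono M (q⊆p∪q P Q)) (r-mono M (⊆-∩ ⊆-refl (flat-absorbs flatQ ⊆-refl (≤-trans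
            (r-mono M (∪-lub (q⊆p∪q P Q) (p⊆p∪q Q))) ρP∪Q≤ρQ))))))
  ... | no ρP∪Q≰ρP | no ρP∪Q≰ρQ = <⇒≢ nonmodular
          (proj₂ hypermodular P Q flatP flatQ (rank3 ρP∪Q≰ρP ρP∪Q≰ρQ nonmodular)
            (rank3 ρP∪Q≰ρQ ρP∪Q≰ρP (subst (ρ (P ∪ Q) + ρ (P ∩ Q) <_) (+-comm (ρ P) (ρ Q)) nonmodular)))
    where
    rank3 : ∀ {p q} → ¬ ρ (P ∪ Q) ≤ p → ¬ ρ (P ∪ Q) ≤ q → ρ (P ∪ Q) + ρ (P ∩ Q) < p + q → p ≡ 3
    rank3 {p} {q} ρP∪Q≰p ρP∪Q≰q ρ∪+ρ∩<p+q = ≤-antisym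
      (≤-pred (<-≤-trans (≰⇒> ρP∪Q≰p) (ρ≤4 (P ∪ Q))))
      (+-cancelˡ-≤ q 3 p (begin
        q + 3                        ≡⟨ +-suc q 2 ⟩
        suc q + 2                    ≤⟨ +-mono-≤ (≰⇒> ρP∪Q≰q) (s≤s (∈⇒ρ≥1 x∈P∩Q)) ⟩
        ρ (P ∪ Q) + suc (ρ (P ∩ Q))  ≡⟨ +-suc (ρ (P ∪ Q)) _ ⟩
        suc (ρ (P ∪ Q) + ρ (P ∩ Q))  ≤⟨ ρ∪+ρ∩<p+q ⟩
        p + q                        ≡⟨ +-comm p q ⟩
        q + p                        ∎))
      where open ≤-Reasoning

  separated-flats-modular : ∀ {S T X Y} → (∀ e → e ∈ S ⊎ e ∈ T) → ρ S + ρ T ≤ ρ ⊤ → Nonempty T →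
                            IsFlat M X → IsFlat M Y → ¬ NonModularPair (X ∩ S) (Y ∩ S)
  separated-flats-modular {S} {T} covers separates (t , t∈T) flatX flatY nonmodular =
    meeting-flats-modular (flat-∩-∪ flatX) (flat-∩-∪ flatY) (t , x∈p∩q⁺ (q⊆p∪q _ T t∈T , q⊆p∪q _ T t∈T))
      (nonmodular-∩-∪ nonmodular)
    where open Separation S T covers separates

  inseparable : ¬ IsModular M → Inseparable M
  inseparable ¬modular S (_ , separates) S-nonempty S≢⊤
    with ¬modular⇒∃nonmodular ¬modular
  ... | X , Y , flatX , flatY , nonmodular =
    [ separated-flats-modular coversST (≤-reflexive separates) T-nonempty flatX flatY
    , separated-flats-modular coversTS (≤-reflexive (trans (+-comm (ρ T) (ρ S)) separates))
                              S-nonempty flatX flatY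
    ] (nonmodular-splits nonmodular)
    where
    T = ⊤ ─ S
    coversST : ∀ e → e ∈ S ⊎ e ∈ T
    coversST e = x∈q⊎x∈p─q ∈⊤
    coversTS : ∀ e → e ∈ T ⊎ e ∈ S
    coversTS e = swap (coversST e)
    T-nonempty : Nonempty T
    T-nonempty with p⊈q⇒∃ (λ ⊤⊆S → S≢⊤ (⊆-antisym ⊆⊤ ⊤⊆S))
    ... | x , _ , x∉S = x , x∈p∧x∉q⇒x∈p─q ∈⊤ x∉S
    open Separation S T coversST (≤-reflexive separates) using (nonmodular-splits)

  ∃-outside-two-planes : ∀ {X Y K K′ x} → Plane X → Plane Y → x ∈ X → x ∈ Y →
                         Line K → K ⊆ X → Empty (K ∩ Y) → Line K′ → K′ ⊆ Y → Empty (K′ ∩ X) →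
                         ∃ λ c → c ∉ X × c ∉ Y
  ∃-outside-two-planes {X} {Y} {K} {K′} {x} planeX@(flatX , _) planeY@(flatY , _) x∈X x∈Y
                       lineK@(flatK , _) K⊆X K∩Y≡∅ lineK′@(flatK′ , _) K′⊆Y K′∩X≡∅
    with line-nonempty (proj₂ lineK) | line-nonempty (proj₂ lineK′)
  ... | a , a∈K | b , b∈K′
    with ∃-third-point lineK (λ x∈K → Empty[p∩q]⇒x∉q K∩Y≡∅ x∈K x∈Y) a∈K
       | ∃-third-point lineK′ (λ x∈K′ → Empty[p∩q]⇒x∉q K′∩X≡∅ x∈K′ x∈X) b∈K′
  ... | a′ , a′∈K , 3≤ρ[a,x,a′] | b′ , b′∈K′ , 3≤ρ[b,x,b′] =
    map₂ proj₂ (∃-avoiding (≤-reflexive (sym ρP∩Q≡2)) ρP∩Q∩X≤1 ρP∩Q∩Y≤1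
                           (x∈p∩q⁺ (x∈P∩Q , x∈X)) (x∈p∩q⁺ (x∈P∩Q , x∈Y)))
    where
    x∉K : x ∉ K
    x∉K x∈K = Empty[p∩q]⇒x∉q K∩Y≡∅ x∈K x∈Y
    x∉K′ : x ∉ K′
    x∉K′ x∈K′ = Empty[p∩q]⇒x∉q K′∩X≡∅ x∈K′ x∈X
    ∈K⇒∉Y : ∀ {e} → e ∈ K → e ∉ Y
    ∈K⇒∉Y = Empty[p∩q]⇒x∉q K∩Y≡∅
    ∈K′⇒∉X : ∀ {e} → e ∈ K′ → e ∉ X
    ∈K′⇒∉X = Empty[p∩q]⇒x∉q K′∩X≡∅
    P = cl (triple a x b′)
    Q = cl (triple b x a′)
    planeP : Plane P
    planeP = cl-plane flatX (pair-⊆ (K⊆X a∈K) x∈X) (ρ-pair-outside-flat flatK a∈K x∉K) (∈K′⇒∉X b′∈K′)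
    planeQ : Plane Q
    planeQ = cl-plane flatY (pair-⊆ (K′⊆Y b∈K′) x∈Y) (ρ-pair-outside-flat flatK′ b∈K′ x∉K′) (∈K⇒∉Y a′∈K)
    a′∉P : a′ ∉ P
    a′∉P a′∈P = <⇒≱ 3≤ρ[a,x,a′] (ρ-⊆-planes-meet planeP planeX (⊆-cl ∈triple₃) (∈K′⇒∉X b′∈K′)
      (⊆-∩ (triple-⊆ (⊆-cl ∈triple₁) (⊆-cl ∈triple₂) a′∈P) (triple-⊆ (K⊆X a∈K) x∈X (K⊆X a′∈K))))
    b′∉Q : b′ ∉ Q
    b′∉Q b′∈Q = <⇒≱ 3≤ρ[b,x,b′] (ρ-⊆-planes-meet planeQ planeY (⊆-cl ∈triple₃) (∈K⇒∉Y a′∈K)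
      (⊆-∩ (triple-⊆ (⊆-cl ∈triple₁) (⊆-cl ∈triple₂) b′∈Q) (triple-⊆ (K′⊆Y b∈K′) x∈Y (K′⊆Y b′∈K′))))
    ρP∩Q≡2 : ρ (P ∩ Q) ≡ 2
    ρP∩Q≡2 = planes-meet-in-line planeP planeQ (⊆-cl ∈triple₃) b′∉Q
    ρP∩Q∩X≤1 : ρ ((P ∩ Q) ∩ X) ≤ 1
    ρP∩Q∩X≤1 = ⊆-line-∩-flat⇒ρ≤1 (planes-meet-in-line planeQ planeX (⊆-cl ∈triple₁) (∈K′⇒∉X b∈K′))
      (proj₁ planeP) (x∈p∩q⁺ (⊆-cl ∈triple₃ , K⊆X a′∈K)) a′∉P
      (⊆-∩ (⊆-∩ (⊆-trans (p∩q⊆p _ X) (p∩q⊆q P Q)) (p∩q⊆q _ X)) (⊆-trans (p∩q⊆p _ X) (p∩q⊆p P Q)))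
    ρP∩Q∩Y≤1 : ρ ((P ∩ Q) ∩ Y) ≤ 1
    ρP∩Q∩Y≤1 = ⊆-line-∩-flat⇒ρ≤1 (planes-meet-in-line planeP planeY (⊆-cl ∈triple₁) (∈K⇒∉Y a∈K))
      (proj₁ planeQ) (x∈p∩q⁺ (⊆-cl ∈triple₃ , K′⊆Y b′∈K′)) b′∉Q
      (⊆-∩ (⊆-∩ (⊆-trans (p∩q⊆p _ Y) (p∩q⊆p P Q)) (p∩q⊆q _ Y)) (⊆-trans (p∩q⊆p _ Y) (p∩q⊆q P Q)))
    x∈P∩Q : x ∈ P ∩ Q
    x∈P∩Q = x∈p∩q⁺ (⊆-cl ∈triple₂ , ⊆-cl ∈triple₂)

module Configuration {m : ℕ} (M : Matroid m) (loopless : Loopless M) (hypermodular : Hypermodular M)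
  (F L : Subset m) (flatF : IsFlat M F) (flatL : IsFlat M L) (F∩L≡∅ : Empty (F ∩ L))
  (ρF≡3 : r M F ≡ 3) (ρL≡2 : r M L ≡ 2) (n : ℕ) (A : Fin n → Subset m)
  (A-injective : ∀ i j → A i ≡ A j → i ≡ j)
  (A-planes-through-L : ∀ X → (IsFlat M X × r M X ≡ 3 × L ⊆ X) ⇔ ∃ (λ i → A i ≡ X)) where

  open HypermodularProperties M loopless hypermodular

  planeF : Plane F
  planeF = flatF , ρF≡3

  lineL : Line L
  lineL = flatL , ρL≡2

  L∩F≡∅ : Empty (L ∩ F)
  L∩F≡∅ (e , e∈L∩F) = F∩L≡∅ (e , x∈p∩q⁺ (p∩q⊆q L F e∈L∩F , p∩q⊆p L F e∈L∩F))

  A-spec : ∀ i → IsFlat M (A i) × ρ (A i) ≡ 3 × L ⊆ A i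
  A-spec i = Equivalence.from (A-planes-through-L (A i)) (i , refl)

  A-plane : ∀ i → Plane (A i)
  A-plane i = proj₁ (A-spec i) , proj₁ (proj₂ (A-spec i))

  L⊆A : ∀ i → L ⊆ A i
  L⊆A i = proj₂ (proj₂ (A-spec i))

  plane-through-L : ∀ {X} → Plane X → L ⊆ X → ∃ λ i → A i ≡ X
  plane-through-L {X} (flatX , ρX≡3) L⊆X = Equivalence.to (A-planes-through-L X) (flatX , ρX≡3 , L⊆X)

  A-distinct : ∀ {i j} → i ≢ j → ∃ λ e → e ∈ A i × e ∉ A j
  A-distinct {i} {j} i≢j = p⊈q⇒∃ λ Ai⊆Aj → i≢j (A-injective i j
    (flat-⊆-≡ (proj₁ (A-plane i)) Ai⊆Aj (≤-reflexive (trans (proj₂ (A-plane j)) (sym (proj₂ (A-plane i)))))))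

  A∩A⊆L : ∀ {i j} → i ≢ j → A i ∩ A j ⊆ L
  A∩A⊆L i≢j = let _ , e∈Ai , e∉Aj = A-distinct i≢j in
    planes-meet-in (A-plane _) (A-plane _) lineL (L⊆A _) (L⊆A _) e∈Ai e∉Aj

  A-disjoint-off-L : ∀ i j → i ≢ j → Empty ((A i ─ L) ∩ (A j ─ L))
  A-disjoint-off-L i j i≢j (e , e∈) =
    let e∈Ai─L , e∈Aj─L = x∈p∩q⁻ (A i ─ L) (A j ─ L) e∈ in
    x∈p─q⇒x∉q e∈Ai─L (A∩A⊆L i≢j (x∈p∩q⁺ (p─q⊆p (A i) L e∈Ai─L , p─q⊆p (A j) L e∈Aj─L)))

  ∈A-of-∉L : ∀ {e} → e ∉ L → ∃ λ i → e ∈ A i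
  ∈A-of-∉L {e} e∉L =
    let i , Ai≡ = plane-through-L (cl-plane flatL ⊆-refl ρL≡2 e∉L) (⊆-trans (p⊆p∪q ⁅ e ⁆) ⊆-cl)
    in i , subst (e ∈_) (sym Ai≡) (⊆-cl (q⊆p∪q L _ (x∈⁅x⁆ e)))

  ∃-∉-of-ρ<4 : ∀ {X} → ρ X < 4 → ∃ λ e → e ∉ X
  ∃-∉-of-ρ<4 {X} ρX<4 = map₂ proj₂ (p⊈q⇒∃ λ ⊤⊆X →
    <⇒≱ ρX<4 (≤-trans (≤-reflexive (sym (proj₁ hypermodular))) (r-mono M ⊤⊆X)))

  A-covers : ∀ e → ∃ λ i → e ∈ A i
  A-covers e with e ∈? L
  ... | no e∉L = ∈A-of-∉L e∉L
  ... | yes e∈L = map₂ (λ _ → L⊆A _ e∈L)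
                   (∈A-of-∉L (proj₂ (∃-∉-of-ρ<4 (≤-trans (s≤s (≤-reflexive ρL≡2)) (n≤1+n 3)))))

  ∃-other : ∀ i → ∃ λ j → j ≢ i
  ∃-other i =
    let e , e∉Ai = ∃-∉-of-ρ<4 (≤-reflexive (cong suc (proj₂ (A-plane i))))
        j , e∈Aj = A-covers e
    in j , λ j≡i → e∉Ai (subst (λ l → e ∈ A l) j≡i e∈Aj)

  x₀ : Fin m
  x₀ = proj₁ (line-nonempty ρL≡2)

  x₀∈L : x₀ ∈ L
  x₀∈L = proj₂ (line-nonempty ρL≡2)

  K : Fin n → Subset m
  K i = A i ∩ F

  K-line : ∀ i → Line (K i)
  K-line i = ∩-flat (proj₁ (A-plane i)) flatF ,
             planes-meet-in-line (A-plane i) planeF (L⊆A i x₀∈L) (Empty[p∩q]⇒x∉q L∩F≡∅ x₀∈L)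

  K⊆A : ∀ {i} → K i ⊆ A i
  K⊆A = p∩q⊆p _ F

  K⊆F : ∀ {i} → K i ⊆ F
  K⊆F = p∩q⊆q _ F

  K∩A≡∅ : ∀ {i j} → i ≢ j → Empty (K i ∩ A j)
  K∩A≡∅ i≢j (e , e∈) =
    let e∈Ki , e∈Aj = x∈p∩q⁻ _ _ e∈ in
    Empty[p∩q]⇒x∉q F∩L≡∅ (K⊆F e∈Ki) (A∩A⊆L i≢j (x∈p∩q⁺ (K⊆A e∈Ki , e∈Aj)))

  ∃-outside-two-A : ∀ {i j} → i ≢ j → ∃ λ c → c ∉ A i × c ∉ A j
  ∃-outside-two-A {i} {j} i≢j = ∃-outside-two-planes (A-plane i) (A-plane j) (L⊆A i x₀∈L) (L⊆A j x₀∈L)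
    (K-line i) K⊆A (K∩A≡∅ i≢j) (K-line j) K⊆A (K∩A≡∅ (i≢j ∘ sym))

  3≤n : 3 ≤ n
  3≤n =
    let i , _ = A-covers x₀
        j , j≢i = ∃-other i
        c , c∉Ai , c∉Aj = ∃-outside-two-A (j≢i ∘ sym)
        _ , c∈Ak = A-covers c
    in three-distinct⇒3≤n (j≢i ∘ sym) (λ i≡k → c∉Ai (subst (λ l → c ∈ A l) (sym i≡k) c∈Ak))
                                      (λ j≡k → c∉Aj (subst (λ l → c ∈ A l) (sym j≡k) c∈Ak))

  A-off-F∪L-of-outside : ∀ {i j a} → j ≢ i → a ∈ K j → (∃ λ c → c ∉ F × c ∉ A j) →
                         Nonempty (A i ─ (F ∪ L))
  A-off-F∪L-of-outside {i} {j} {a} j≢i a∈Kj (c , c∉F , c∉Aj) =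
    e , x∈p∧x∉q⇒x∈p─q e∈Ai ([ e∉F , e∉L ]′ ∘ x∈p∪q⁻ F L)
    where
    G = cl (K j ∪ ⁅ c ⁆)
    planeG : Plane G
    planeG = cl-plane flatF K⊆F (proj₂ (K-line j)) c∉F
    c∈G : c ∈ G
    c∈G = ⊆-cl (q⊆p∪q _ _ (x∈⁅x⁆ c))
    Kj⊆G : K j ⊆ G
    Kj⊆G = ⊆-trans (p⊆p∪q _) ⊆-cl
    G∩Ai-nonempty : Nonempty (G ∩ A i)
    G∩Ai-nonempty = line-nonempty (planes-meet-in-line planeG (A-plane i) (Kj⊆G a∈Kj)
                                     (Empty[p∩q]⇒x∉q (K∩A≡∅ j≢i) a∈Kj))
    e = proj₁ G∩Ai-nonempty
    e∈G : e ∈ G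
    e∈G = p∩q⊆p G (A i) (proj₂ G∩Ai-nonempty)
    e∈Ai : e ∈ A i
    e∈Ai = p∩q⊆q G (A i) (proj₂ G∩Ai-nonempty)
    e∉F : e ∉ F
    e∉F e∈F = Empty[p∩q]⇒x∉q F∩L≡∅ e∈F (A∩A⊆L (j≢i ∘ sym) (x∈p∩q⁺ (e∈Ai , K⊆A e∈Kj)))
      where
      e∈Kj : e ∈ K j
      e∈Kj = planes-meet-in planeG planeF (K-line j) Kj⊆G K⊆F c∈G c∉F (x∈p∩q⁺ (e∈G , e∈F))
    e∉L : e ∉ L
    e∉L e∈L = Empty[p∩q]⇒x∉q F∩L≡∅
      (K⊆F (planes-meet-in planeG (A-plane j) (K-line j) Kj⊆G K⊆A c∈G c∉Aj (x∈p∩q⁺ (e∈G , L⊆A j e∈L)))) e∈L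

  A-off-F∪L-of-other : ∀ {i j} → j ≢ i → Nonempty (A i ─ (F ∪ L))
  A-off-F∪L-of-other {i} {j} j≢i with line-nonempty (proj₂ (K-line j))
  ... | a , a∈Kj = A-off-F∪L-of-outside j≢i a∈Kj
    (∃-outside-two-planes planeF (A-plane j) (K⊆F a∈Kj) (K⊆A a∈Kj)
                          (K-line i) K⊆F (K∩A≡∅ (j≢i ∘ sym)) lineL (L⊆A j) L∩F≡∅)

  A-off-F∪L : ∀ i → Nonempty (A i ─ (F ∪ L))
  A-off-F∪L i = A-off-F∪L-of-other (proj₂ (∃-other i))

  A-inseparable : ∀ i → InseparableSet M (A i)
  A-inseparable i = inseparable-with-disjoint-lines (proj₂ (A-plane i)) lineL (K-line i) (L⊆A i) K⊆A
    λ (e , e∈L∩Ki) → Empty[p∩q]⇒x∉q F∩L≡∅ (K⊆F (p∩q⊆q L (K i) e∈L∩Ki)) (p∩q⊆p L (K i) e∈L∩Ki)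

  F-inseparable : InseparableSet M F
  F-inseparable =
    let i , _ = A-covers x₀
        j , j≢i = ∃-other i
    in inseparable-with-disjoint-lines ρF≡3 (K-line i) (K-line j) K⊆F K⊆F λ (e , e∈Ki∩Kj) →
         K∩A≡∅ (j≢i ∘ sym) (e , x∈p∩q⁺ (p∩q⊆p (K i) (K j) e∈Ki∩Kj , K⊆A (p∩q⊆q (K i) (K j) e∈Ki∩Kj)))

lemma3p5 : ∀ {m : ℕ} (M : Matroid m) →
  Loopless M → HasRank M 4 → Hypermodular M → ¬ IsModular M →
  Inseparable M ×
  (∀ (F L : Subset m) → IsFlat M F → IsFlat M L → Empty (F ∩ L) →
    r M F ≡ 3 → r M L ≡ 2 →
    ∀ (n : ℕ) (A : Fin n → Subset m) →
    (∀ i j → A i ≡ A j → i ≡ j) →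
    (∀ X → (IsFlat M X × r M X ≡ 3 × L ⊆ X) ⇔ ∃ (λ i → A i ≡ X)) →
    (∀ e → ∃ (λ i → e ∈ A i)) ×
    3 ≤ n ×
    (∀ i j → i ≢ j → Empty ((A i ─ L) ∩ (A j ─ L))) ×
    (∀ i → Nonempty (A i ─ (F ∪ L))) ×
    (∀ i → InseparableSet M (A i)) ×
    InseparableSet M F)
lemma3p5 M loopless _ hypermodular ¬modular =
  HypermodularProperties.inseparable M loopless hypermodular ¬modular ,
  λ F L flatF flatL F∩L≡∅ ρF≡3 ρL≡2 n A A-injective A-planes-through-L →
    let open Configuration M loopless hypermodular F L flatF flatL F∩L≡∅ ρF≡3 ρL≡2
                           n A A-injective A-planes-through-L
    in A-covers , 3≤n , A-disjoint-off-L , A-off-F∪L , A-inseparable , F-inseparable
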